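{- When $\alpha$ is a safe formula, the constrained LTLf specification $\mathcal{S}=\langle \mathcal{X}, \mathcal{Y}, \alpha, \varphi \rangle$ is realizable iff the LTLf specification $\mathcal{S}'=\langle \mathcal{X}, \mathcal{Y}, \alpha' \rightarrow \varphi \rangle$ is realizable, where $\alpha'$ is obtained from $\alpha$ by replacing every occurrence of $\mathsf{X}\psi$ (next) by $\mathsf{N}\psi$ (weak next).
   Context: Let $\mathcal{X}$ (uncontrollable) and $\mathcal{Y}$ (controllable) be disjoint finite sets of propositional variables. LTL formulas are interpreted over infinite traces; LTLf formulas have the same syntax but are interpreted over finite traces, where $\mathsf{X}\psi$ (strong next) holds at step $i$ only if a step $i+1$ exists and $\psi$ holds there, and weak next is the abbreviation $\mathsf{N}\psi := \mathsf{X}\psi \vee \neg\mathsf{X}\top$ (true also at the last step). The safe fragment of LTL is given by $\varphi ::= \top \mid \bot \mid p \mid \neg p \mid \varphi_1\wedge\varphi_2 \mid \varphi_1\vee\varphi_2 \mid \mathsf{X}\varphi \mid \varphi_1\,\mathcal{R}\,\varphi_2$ (negation only on atoms, release $\mathcal{R}$ instead of until); any infinite trace violating a safe formula has a finite bad prefix. An LTLf specification $\langle \mathcal{X}, \mathcal{Y}, \psi \rangle$ is realizable if there is a strategy $\sigma: (2^{\mathcal{X}})^* \rightarrow 2^{\mathcal{Y} \cup \{\mathsf{end}\}}$ that, for every infinite sequence $\mathbf{X}=X_1X_2\ldots$ of subsets of $\mathcal{X}$, outputs $\mathsf{end}$ at exactly one step $n$, with every induced finite trace $(X_1\cup\sigma(X_1))\cdots(X_n\cup\sigma(X_1\cdots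 X_n))$ (with $\mathsf{end}$ removed) satisfying $\psi$. A constrained LTLf specification $\langle \mathcal{X}, \mathcal{Y}, \alpha, \varphi \rangle$ has an LTLf objective $\varphi$ and an LTL assumption $\alpha$ (infinite semantics); strategies output $\mathsf{end}$ at most once per $\mathbf{X}$; a strategy is an $\alpha$-strategy if for every $\mathbf{X}$ either it outputs $\mathsf{end}$ at some finite step or the induced infinite trace $(X_1\cup\sigma(X_1))(X_2\cup\sigma(X_1X_2))\cdots$ violates $\alpha$; it is winning if it is an $\alpha$-strategy and every induced finite trace satisfies $\varphi$; realizable means a winning strategy exists. -}

module Defs where

open import Data.Nat using (ℕ; zero; suc; _≤_; _<_)
open import Data.Fin using (Fin)
open import Data.Bool using (Bool; true; false)
open import Data.List using (List; map; upTo)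
open import Data.Sum using (_⊎_; inj₁; inj₂)
open import Data.Product using (Σ; _×_; _,_; proj₁; proj₂; ∃-syntax)
open import Data.Unit using (⊤)
open import Data.Empty using (⊥)
open import Relation.Nullary using (¬_)
open import Relation.Binary.PropositionalEquality using (_≡_)

data LTL (V : Set) : Set where
  tt ff   : LTL V
  atom    : V → LTL V
  not     : LTL V → LTL V
  and or  : LTL V → LTL V → LTL V
  next    : LTL V → LTL V
  until   : LTL V → LTL V → LTL V
  release : LTL V → LTL V → LTL V

imp : ∀ {V} → LTL V → LTL V → LTL V
imp a b = or (not a) b

wnext : ∀ {V} → LTL V → LTL V
wnext ψ = or (next ψ) (not (next tt))

weaken : ∀ {V} → LTL V → LTL V
weaken tt            = tt
weaken ff            = ff
weaken (atom p)      = atom p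
weaken (not a)       = not (weaken a)
weaken (and a b)     = and (weaken a) (weaken b)
weaken (or a b)      = or (weaken a) (weaken b)
weaken (next a)      = wnext (weaken a)
weaken (until a b)   = until (weaken a) (weaken b)
weaken (release a b) = release (weaken a) (weaken b)

data Safe {V : Set} : LTL V → Set where
  s-tt      : Safe tt
  s-ff      : Safe ff
  s-atom    : ∀ p → Safe (atom p)
  s-natom   : ∀ p → Safe (not (atom p))
  s-and     : ∀ {a b} → Safe a → Safe b → Safe (and a b)
  s-or      : ∀ {a b} → Safe a → Safe b → Safe (or a b)
  s-next    : ∀ {a} → Safe a → Safe (next a)
  s-release : ∀ {a b} → Safe a → Safe b → Safe (release a b)

Val : Set → Set
Val V = V → Bool

sat∞ : ∀ {V} → (ℕ → Val V) → ℕ → LTL V → Set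
sat∞ π i tt            = ⊤
sat∞ π i ff            = ⊥
sat∞ π i (atom p)      = π i p ≡ true
sat∞ π i (not a)       = ¬ sat∞ π i a
sat∞ π i (and a b)     = sat∞ π i a × sat∞ π i b
sat∞ π i (or a b)      = sat∞ π i a ⊎ sat∞ π i b
sat∞ π i (next a)      = sat∞ π (suc i) a
sat∞ π i (until a b)   =
  ∃[ k ] (i ≤ k × sat∞ π k b × (∀ j → i ≤ j → j < k → sat∞ π j a))
sat∞ π i (release a b) =
  ∀ k → i ≤ k → sat∞ π k b ⊎ (∃[ j ] (i ≤ j × j < k × sat∞ π j a))

-- finite traces (LTLf): the trace w 0 … w (len-1) of length len
satF : ∀ {V} → ℕ → (ℕ → Val V) → ℕ → LTL V → Set
satF len w i tt            = ⊤
satF len w i ff            = ⊥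
satF len w i (atom p)      = w i p ≡ true
satF len w i (not a)       = ¬ satF len w i a
satF len w i (and a b)     = satF len w i a × satF len w i b
satF len w i (or a b)      = satF len w i a ⊎ satF len w i b
satF len w i (next a)      = suc i < len × satF len w (suc i) a
satF len w i (until a b)   =
  ∃[ k ] (i ≤ k × k < len × satF len w k b × (∀ j → i ≤ j → j < k → satF len w j a))
satF len w i (release a b) =
  ∀ k → i ≤ k → k < len → satF len w k b ⊎ (∃[ j ] (i ≤ j × j < k × satF len w j a))

_,_⊨f_ : ∀ {V} → ℕ → (ℕ → Val V) → LTL V → Set
len , w ⊨f φ = satF len w 0 φ

-- Synthesis.  𝒳 = Fin nx (uncontrollable), 𝒴 = Fin ny (controllable);
-- the propositions are Fin nx ⊎ Fin ny (disjoint union).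

Prop : ℕ → ℕ → Set
Prop nx ny = Fin nx ⊎ Fin ny

-- strategy σ : (2^𝒳)* → 2^(𝒴 ∪ {end}); the Bool component is `end`
Strategy : ℕ → ℕ → Set
Strategy nx ny = List (Val (Fin nx)) → Val (Fin ny) × Bool

-- X₁ … Xₖ from an infinite input sequence (0-indexed: X 0 … X (k-1))
prefix : ∀ {A : Set} → (ℕ → A) → ℕ → List A
prefix X k = map X (upTo k)

-- output of σ at (0-indexed) step i, i.e. σ(X₁ ⋯ X_{i+1})
out : ∀ {nx ny} → Strategy nx ny → (ℕ → Val (Fin nx)) → ℕ → Val (Fin ny) × Bool
out σ X i = σ (prefix X (suc i))

Ends : ∀ {nx ny} → Strategy nx ny → (ℕ → Val (Fin nx)) → ℕ → Set
Ends σ X i = proj₂ (out σ X i) ≡ true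

-- induced (infinite) trace: position i is X i ∪ σ(X 0 … X i)  (end removed)
play : ∀ {nx ny} → Strategy nx ny → (ℕ → Val (Fin nx)) → ℕ → Val (Prop nx ny)
play σ X i (inj₁ x) = X i x
play σ X i (inj₂ y) = proj₁ (out σ X i) y

-- LTLf realizability of ⟨𝒳, 𝒴, ψ⟩: end exactly once, and the induced
-- finite trace up to (and including) the end step satisfies ψ
RealizableF : (nx ny : ℕ) → LTL (Prop nx ny) → Set
RealizableF nx ny ψ =
  Σ (Strategy nx ny) λ σ → ∀ (X : ℕ → Val (Fin nx)) →
    ∃[ n ] (Ends σ X n × (∀ m → Ends σ X m → m ≡ n) × (suc n , play σ X ⊨f ψ))

AtMostOnce : ∀ {nx ny} → Strategy nx ny → Set
AtMostOnce {nx} σ = ∀ (X : ℕ → Val (Fin nx)) m n → Ends σ X m → Ends σ X n → m ≡ n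

IsAlphaStrategy : ∀ {nx ny} → LTL (Prop nx ny) → Strategy nx ny → Set
IsAlphaStrategy {nx} α σ = ∀ (X : ℕ → Val (Fin nx)) →
  (∃[ n ] Ends σ X n) ⊎ (¬ sat∞ (play σ X) 0 α)

IsWinning : ∀ {nx ny} → LTL (Prop nx ny) → LTL (Prop nx ny) → Strategy nx ny → Set
IsWinning {nx} α φ σ = IsAlphaStrategy α σ ×
  (∀ (X : ℕ → Val (Fin nx)) n → Ends σ X n → suc n , play σ X ⊨f φ)

RealizableC : (nx ny : ℕ) → LTL (Prop nx ny) → LTL (Prop nx ny) → Set
RealizableC nx ny α φ = Σ (Strategy nx ny) λ σ → AtMostOnce σ × IsWinning α φ σ

module Submission where

-- The heart of the argument is a correspondence between the infinite
-- semantics of a safe α and the finite semantics of α' on prefixes: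
--   * if α holds on an infinite trace, then α' holds on every nonempty prefix;
--   * α' is preserved when a prefix is shortened;
--   * (classically) if α fails on an infinite trace, some prefix violates α'.
-- Strategy transformation is done by keeping the outputs of a strategy and
-- recomputing its end bit from a predicate of the input prefix
-- ("rescheduling"), which needs excluded middle to decide the predicate.
--   ⇒ Reschedule a winning α-strategy to end at the first step where it has
--     ended or α' is already violated; it then satisfies α' → φ there.
--   ⇒ Reschedule a strategy for α' → φ to end only where α' still holds;
--     when it does not end, α' failed on a prefix, so α fails forever.

open import Defs
open import Data.Nat using (ℕ; zero; suc; _≤_; _<_; _⊔_; z≤n; s≤s; _≤?_; _<?_)
open import Data.Nat.Properties
  using (≤-refl; ≤-trans; <-trans; <-≤-trans; ≤-<-trans; <⇒≤; n<1+n; m<n⇒m<1+n;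
         m<1+n⇒m<n∨m≡n; m≤m⊔n; m≤n⊔m; suc-injective; <-cmp)
open import Data.Nat.Induction using (<-rec)
open import Level using (0ℓ)
open import Axiom.ExcludedMiddle using (ExcludedMiddle)
open import Axiom.DoubleNegationElimination using (em⇒dne)
open import Function.Bundles using (_⇔_; mk⇔)
open import Data.Fin using (Fin)
open import Data.Bool using (true)
open import Data.List using (List; _∷_; applyUpTo; length)
open import Data.List.Properties using (map-upTo; length-applyUpTo; ∷-injective)
open import Data.Sum using (_⊎_; inj₁; inj₂)
open import Data.Product using (Σ; _×_; _,_; proj₁; proj₂; ∃-syntax)
open import Data.Unit using () renaming (tt to ⋆)
open import Data.Empty using (⊥-elim)
open import Relation.Nullary using (¬_; yes; no; does)
open import Relation.Nullary.Decidable using (dec-true)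
open import Relation.Binary.Definitions using (tri<; tri≈; tri>)
open import Relation.Binary.PropositionalEquality using (_≡_; refl; sym; trans; cong; cong₂; subst)

LEM : Set₁
LEM = ExcludedMiddle 0ℓ

Agree : ∀ {A : Set} → (ℕ → A) → (ℕ → A) → ℕ → Set
Agree X X' n = ∀ i → i < n → X i ≡ X' i

agree-sym : ∀ {A : Set} {X X' : ℕ → A} {n} → Agree X X' n → Agree X' X n
agree-sym ag i i<n = sym (ag i i<n)

agree-≤ : ∀ {A : Set} {X X' : ℕ → A} {m n} → m ≤ n → Agree X X' n → Agree X X' m
agree-≤ m≤n ag i i<m = ag i (<-≤-trans i<m m≤n)

applyUpTo≡⇒agree : ∀ {A : Set} (X X' : ℕ → A) k → applyUpTo X k ≡ applyUpTo X' k → Agree X X' k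
applyUpTo≡⇒agree X X' (suc k) eq zero    _         = proj₁ (∷-injective eq)
applyUpTo≡⇒agree X X' (suc k) eq (suc i) (s≤s i<k) =
  applyUpTo≡⇒agree (λ j → X (suc j)) (λ j → X' (suc j)) k (proj₂ (∷-injective eq)) i i<k

agree⇒applyUpTo≡ : ∀ {A : Set} (X X' : ℕ → A) k → Agree X X' k → applyUpTo X k ≡ applyUpTo X' k
agree⇒applyUpTo≡ X X' zero    ag = refl
agree⇒applyUpTo≡ X X' (suc k) ag =
  cong₂ _∷_ (ag 0 (s≤s z≤n))
    (agree⇒applyUpTo≡ (λ j → X (suc j)) (λ j → X' (suc j)) k (λ i i<k → ag (suc i) (s≤s i<k)))

prefix≡⇒agree : ∀ {A : Set} (X X' : ℕ → A) k → prefix X k ≡ prefix X' k → Agree X X' k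
prefix≡⇒agree X X' k eq =
  applyUpTo≡⇒agree X X' k (trans (sym (map-upTo X k)) (trans eq (map-upTo X' k)))

agree⇒prefix≡ : ∀ {A : Set} (X X' : ℕ → A) k → Agree X X' k → prefix X k ≡ prefix X' k
agree⇒prefix≡ X X' k ag =
  trans (map-upTo X k) (trans (agree⇒applyUpTo≡ X X' k ag) (sym (map-upTo X' k)))

length-prefix : ∀ {A : Set} (X : ℕ → A) k → length (prefix X k) ≡ k
length-prefix X k = trans (cong length (map-upTo X k)) (length-applyUpTo X k)

SameUpTo : ∀ {V : Set} → ℕ → (ℕ → Val V) → (ℕ → Val V) → Set
SameUpTo len w w' = ∀ i → i < len → ∀ p → w i p ≡ w' i p

sameUpTo-sym : ∀ {V : Set} {len} {w w' : ℕ → Val V} → SameUpTo len w w' → SameUpTo len w' w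
sameUpTo-sym eq i i<len p = sym (eq i i<len p)

out-agree : ∀ {nx ny} (σ : Strategy nx ny) {X X' n} → Agree X X' (suc n) →
  ∀ {i} → i ≤ n → out σ X i ≡ out σ X' i
out-agree σ {X} {X'} ag {i} i≤n = cong σ (agree⇒prefix≡ X X' (suc i) (agree-≤ (s≤s i≤n) ag))

ends-agree : ∀ {nx ny} (σ : Strategy nx ny) {X X' n} → Agree X X' (suc n) →
  ∀ {i} → i ≤ n → Ends σ X i → Ends σ X' i
ends-agree σ ag i≤n = subst (λ o → proj₂ o ≡ true) (out-agree σ ag i≤n)

play-agree : ∀ {nx ny} (σ : Strategy nx ny) {X X' n} → Agree X X' (suc n) →
  ∀ {m} → m ≤ n → SameUpTo (suc m) (play σ X) (play σ X')
play-agree σ ag m≤n i (s≤s i≤m) (inj₁ x) = cong (λ v → v x) (ag i (s≤s (≤-trans i≤m m≤n)))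
play-agree σ ag m≤n i (s≤s i≤m) (inj₂ y) =
  cong (λ o → proj₁ o y) (out-agree σ ag (≤-trans i≤m m≤n))

satF-local : ∀ {V : Set} {len} {w w' : ℕ → Val V} → SameUpTo len w w' →
  ∀ a i → i < len → satF len w i a → satF len w' i a
satF-local eq tt            i i<len h = h
satF-local eq ff            i i<len ()
satF-local eq (atom p)      i i<len h = trans (sym (eq i i<len p)) h
satF-local eq (not a)       i i<len h = λ h' → h (satF-local (sameUpTo-sym eq) a i i<len h')
satF-local eq (and a b)     i i<len (ha , hb) = satF-local eq a i i<len ha , satF-local eq b i i<len hb
satF-local eq (or a b)      i i<len (inj₁ ha) = inj₁ (satF-local eq a i i<len ha)
satF-local eq (or a b)      i i<len (inj₂ hb) = inj₂ (satF-local eq b i i<len hb)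
satF-local eq (next a)      i i<len (l , h) = l , satF-local eq a (suc i) l h
satF-local eq (until a b)   i i<len (k , i≤k , k<len , hb , ha) =
  k , i≤k , k<len , satF-local eq b k k<len hb ,
  λ j i≤j j<k → satF-local eq a j (<-trans j<k k<len) (ha j i≤j j<k)
satF-local eq (release a b) i i<len h k i≤k k<len with h k i≤k k<len
... | inj₁ hb                 = inj₁ (satF-local eq b k k<len hb)
... | inj₂ (j , i≤j , j<k , ha) = inj₂ (j , i≤j , j<k , satF-local eq a j (<-trans j<k k<len) ha)

⊨f-local : ∀ {V : Set} {n} {w w' : ℕ → Val V} → SameUpTo (suc n) w w' →
  ∀ a → suc n , w ⊨f a → suc n , w' ⊨f a
⊨f-local eq a = satF-local eq a 0 (s≤s z≤n)

module SafeFormulas {V : Set} (π : ℕ → Val V) where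

  safe⇒weak-on-prefixes : ∀ {a : LTL V} → Safe a → ∀ {i len} → i < len →
    sat∞ π i a → satF len π i (weaken a)
  safe⇒weak-on-prefixes s-tt              i<len h = h
  safe⇒weak-on-prefixes s-ff              i<len ()
  safe⇒weak-on-prefixes (s-atom p)        i<len h = h
  safe⇒weak-on-prefixes (s-natom p)       i<len h = h
  safe⇒weak-on-prefixes (s-and sa sb)     i<len (ha , hb) =
    safe⇒weak-on-prefixes sa i<len ha , safe⇒weak-on-prefixes sb i<len hb
  safe⇒weak-on-prefixes (s-or sa sb)      i<len (inj₁ ha) = inj₁ (safe⇒weak-on-prefixes sa i<len ha)
  safe⇒weak-on-prefixes (s-or sa sb)      i<len (inj₂ hb) = inj₂ (safe⇒weak-on-prefixes sb i<len hb)
  safe⇒weak-on-prefixes (s-next sa) {i} {len} i<len h with suc i <? len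
  ... | yes l = inj₁ (l , safe⇒weak-on-prefixes sa l h)
  ... | no ¬l = inj₂ (λ (l , _) → ¬l l)
  safe⇒weak-on-prefixes (s-release sa sb) i<len h k i≤k k<len with h k i≤k
  ... | inj₁ hb                   = inj₁ (safe⇒weak-on-prefixes sb k<len hb)
  ... | inj₂ (j , i≤j , j<k , ha) = inj₂ (j , i≤j , j<k , safe⇒weak-on-prefixes sa (<-trans j<k k<len) ha)

  weak-shorten : ∀ {a : LTL V} → Safe a → ∀ {i len' len} → i < len' → len' ≤ len →
    satF len π i (weaken a) → satF len' π i (weaken a)
  weak-shorten s-tt              i<len' le h = h
  weak-shorten s-ff              i<len' le ()
  weak-shorten (s-atom p)        i<len' le h = h
  weak-shorten (s-natom p)       i<len' le h = h
  weak-shorten (s-and sa sb)     i<len' le (ha , hb) = weak-shorten sa i<len' le ha , weak-shorten sb i<len' le hb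
  weak-shorten (s-or sa sb)      i<len' le (inj₁ ha) = inj₁ (weak-shorten sa i<len' le ha)
  weak-shorten (s-or sa sb)      i<len' le (inj₂ hb) = inj₂ (weak-shorten sb i<len' le hb)
  weak-shorten (s-next sa) {i} {len'} i<len' le (inj₁ (_ , h)) with suc i <? len'
  ... | yes l = inj₁ (l , weak-shorten sa l le h)
  ... | no ¬l = inj₂ (λ (l , _) → ¬l l)
  weak-shorten (s-next sa)       i<len' le (inj₂ last) = inj₂ (λ (l , h) → last (<-≤-trans l le , h))
  weak-shorten (s-release sa sb) i<len' le h k i≤k k<len' with h k i≤k (<-≤-trans k<len' le)
  ... | inj₁ hb                   = inj₁ (weak-shorten sb k<len' le hb)
  ... | inj₂ (j , i≤j , j<k , ha) = inj₂ (j , i≤j , j<k , weak-shorten sa (<-trans j<k k<len') le ha)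

  BadPrefix : LTL V → ℕ → ℕ → Set
  BadPrefix a i L = i < L × ¬ satF L π i (weaken a)

  badPrefix-mono : ∀ {a} → Safe a → ∀ {i L L'} → L ≤ L' → BadPrefix a i L → BadPrefix a i L'
  badPrefix-mono sa L≤L' (i<L , bad) = <-≤-trans i<L L≤L' , λ h → bad (weak-shorten sa i<L L≤L' h)

bounded-choice : (Q : ℕ → ℕ → Set) → (∀ {j L L'} → L ≤ L' → Q j L → Q j L') →
  ∀ k → (∀ j → j < k → ∃[ L ] Q j L) → ∃[ M ] (∀ j → j < k → Q j M)
bounded-choice Q mono zero    h = 0 , λ j ()
bounded-choice Q mono (suc k) h = M ⊔ L , common
  where
  below = bounded-choice Q mono k (λ j j<k → h j (m<n⇒m<1+n j<k))
  M = proj₁ below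
  L = proj₁ (h k ≤-refl)
  common : ∀ j → j < suc k → Q j (M ⊔ L)
  common j j<1+k with m<1+n⇒m<n∨m≡n j<1+k
  ... | inj₁ j<k  = mono (m≤m⊔n M L) (proj₂ below j j<k)
  ... | inj₂ refl = mono (m≤n⊔m M L) (proj₂ (h k ≤-refl))

module BadPrefixes (lem : LEM) {V : Set} (π : ℕ → Val V) where
  open SafeFormulas π

  dne : ∀ {P : Set} → ¬ ¬ P → P
  dne = em⇒dne lem

  release-counterexample : ∀ {a b : LTL V} {i} → ¬ sat∞ π i (release a b) →
    ∃[ k ] (i ≤ k × ¬ sat∞ π k b × (∀ j → i ≤ j → j < k → ¬ sat∞ π j a))
  release-counterexample h = dne λ none → h λ k i≤k → dne λ ¬holds →
    none (k , i≤k , (λ hb → ¬holds (inj₁ hb)) ,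
          λ j i≤j j<k ha → ¬holds (inj₂ (j , i≤j , j<k , ha)))

  safe-bad-prefix : ∀ {a} → Safe a → ∀ i → ¬ sat∞ π i a → ∃[ L ] BadPrefix a i L
  safe-bad-prefix s-tt        i h = ⊥-elim (h ⋆)
  safe-bad-prefix s-ff        i h = suc i , n<1+n i , λ ()
  safe-bad-prefix (s-atom p)  i h = suc i , n<1+n i , h
  safe-bad-prefix (s-natom p) i h = suc i , n<1+n i , h
  safe-bad-prefix (s-and {a} sa sb) i h with lem {sat∞ π i a}
  ... | yes ha = let (L , i<L , bad) = safe-bad-prefix sb i (λ hb → h (ha , hb))
                 in L , i<L , λ (_ , hb) → bad hb
  ... | no ¬ha = let (L , i<L , bad) = safe-bad-prefix sa i ¬ha
                 in L , i<L , λ (ha , _) → bad ha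
  safe-bad-prefix (s-or sa sb) i h with safe-bad-prefix sa i (λ ha → h (inj₁ ha))
                                      | safe-bad-prefix sb i (λ hb → h (inj₂ hb))
  ... | La , badA | Lb , badB = La ⊔ Lb , proj₁ badA′ , λ
    { (inj₁ ha) → proj₂ badA′ ha
    ; (inj₂ hb) → proj₂ (badPrefix-mono sb (m≤n⊔m La Lb) badB) hb }
    where badA′ = badPrefix-mono sa (m≤m⊔n La Lb) badA
  safe-bad-prefix (s-next sa) i h with safe-bad-prefix sa (suc i) h
  ... | L , i+1<L , bad = L , <-trans (n<1+n i) i+1<L , λ
    { (inj₁ (_ , ha)) → bad ha
    ; (inj₂ last)     → last (i+1<L , ⋆) }
  safe-bad-prefix (s-release {a} {b} sa sb) i h with release-counterexample {a} {b} h
  ... | k , i≤k , ¬hb , ¬ha = Lb ⊔ Ma , ≤-<-trans i≤k (proj₁ badB) , refute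
    where
    -- the failure of b at k, and of a at each j ∈ [i, k), as bad prefixes
    -- of one common length
    early : ∀ j → j < k → ∃[ L ] (i ≤ j → BadPrefix a j L)
    early j j<k with i ≤? j
    ... | yes i≤j = let (L , bad) = safe-bad-prefix sa j (¬ha j i≤j j<k) in L , λ _ → bad
    ... | no  i≰j = 0 , λ i≤j → ⊥-elim (i≰j i≤j)
    Lb = proj₁ (safe-bad-prefix sb k ¬hb)
    choice = bounded-choice (λ j L → i ≤ j → BadPrefix a j L)
               (λ L≤L' bad i≤j → badPrefix-mono sa L≤L' (bad i≤j)) k early
    Ma = proj₁ choice
    badB = badPrefix-mono sb (m≤m⊔n Lb Ma) (proj₂ (safe-bad-prefix sb k ¬hb))
    refute : ¬ satF (Lb ⊔ Ma) π i (weaken (release a b))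
    refute f with f k i≤k (proj₁ badB)
    ... | inj₁ hb                   = proj₂ badB hb
    ... | inj₂ (j , i≤j , j<k , ha) =
      proj₂ (badPrefix-mono sa (m≤n⊔m Lb Ma) (proj₂ choice j j<k i≤j)) ha

Minimal : (ℕ → Set) → ℕ → Set
Minimal P n = P n × (∀ k → k < n → ¬ P k)

minimal-witness : LEM → (P : ℕ → Set) → ∀ {m} → P m → ∃[ n ] Minimal P n
minimal-witness lem P {m} = <-rec (λ m → P m → ∃[ n ] Minimal P n) step m
  where
  step : ∀ m → (∀ {k} → k < m → P k → ∃[ n ] Minimal P n) → P m → ∃[ n ] Minimal P n
  step m smaller pm with lem {∃[ k ] (k < m × P k)}
  ... | yes (k , k<m , pk) = smaller k<m pk
  ... | no none            = m , pm , λ k k<m pk → none (k , k<m , pk)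

minimal-unique : ∀ {P m n} → Minimal P m → Minimal P n → m ≡ n
minimal-unique {m = m} {n} (pm , below-m) (pn , below-n) with <-cmp m n
... | tri< m<n _ _ = ⊥-elim (below-n m m<n pm)
... | tri≈ _ m≡n _ = m≡n
... | tri> _ _ n<m = ⊥-elim (below-m n n<m pn)

PrefixInvariant : ∀ {nx} → ((ℕ → Val (Fin nx)) → ℕ → Set) → Set
PrefixInvariant {nx} Q = ∀ {X X' : ℕ → Val (Fin nx)} {n} → Agree X X' (suc n) → Q X n → Q X' n

module Reschedule (lem : LEM) {nx ny : ℕ} (τ : Strategy nx ny)
  (Q : (ℕ → Val (Fin nx)) → ℕ → Set) (Q-inv : PrefixInvariant Q) where

  EndHistory : List (Val (Fin nx)) → Set
  EndHistory h = Σ (ℕ → Val (Fin nx)) λ X → Σ ℕ λ n → prefix X (suc n) ≡ h × Q X n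

  rescheduled : Strategy nx ny
  rescheduled h = proj₁ (τ h) , does (lem {EndHistory h})

  -- the witnessing sequence has a prefix of the same length, hence the
  -- same step n, and agrees with X up to it
  ends⇒Q : ∀ X n → Ends rescheduled X n → Q X n
  ends⇒Q X n e with lem {EndHistory (prefix X (suc n))}
  ends⇒Q X n refl | yes (X' , n' , eq , q) with
    suc-injective (trans (sym (length-prefix X' (suc n'))) (trans (cong length eq) (length-prefix X (suc n))))
  ... | refl = Q-inv (prefix≡⇒agree X' X (suc n) eq) q

  Q⇒ends : ∀ X n → Q X n → Ends rescheduled X n
  Q⇒ends X n q = dec-true (lem {EndHistory (prefix X (suc n))}) (X , n , refl , q)

  same-play : ∀ X len → SameUpTo len (play τ X) (play rescheduled X)
  same-play X len i _ (inj₁ x) = refl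
  same-play X len i _ (inj₂ y) = refl

module Directions (lem : LEM) (nx ny : ℕ) (α φ : LTL (Prop nx ny)) (sa : Safe α) where

  α' : LTL (Prop nx ny)
  α' = weaken α

  forward : RealizableC nx ny α φ → RealizableF nx ny (imp α' φ)
  forward (σ , _ , α-strategy , wins) = σ' , realizes
    where
    Stop : (ℕ → Val (Fin nx)) → ℕ → Set
    Stop X n = Ends σ X n ⊎ ¬ suc n , play σ X ⊨f α'

    stop-agree : ∀ {X X' n m} → Agree X X' (suc n) → m ≤ n → Stop X m → Stop X' m
    stop-agree ag m≤n (inj₁ e)  = inj₁ (ends-agree σ ag m≤n e)
    stop-agree ag m≤n (inj₂ ¬h) = inj₂ (λ h → ¬h (⊨f-local (play-agree σ (agree-sym ag) m≤n) α' h))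

    first-stop-agree : PrefixInvariant (λ X → Minimal (Stop X))
    first-stop-agree ag (stop , earlier) =
      stop-agree ag ≤-refl stop , λ m m<n s → earlier m m<n (stop-agree (agree-sym ag) (<⇒≤ m<n) s)

    open Reschedule lem σ (λ X → Minimal (Stop X)) first-stop-agree
    σ' = rescheduled

    -- an α-strategy stops on every input: α fails, hence α' fails on a prefix
    eventually-stops : ∀ X → ∃[ n ] Stop X n
    eventually-stops X with α-strategy X
    ... | inj₁ (n , e) = n , inj₁ e
    ... | inj₂ ¬α with BadPrefixes.safe-bad-prefix lem (play σ X) sa 0 ¬α
    ...   | suc n , _ , bad = n , inj₂ bad

    stop⇒spec : ∀ X n → Stop X n → suc n , play σ' X ⊨f imp α' φ
    stop⇒spec X n s = ⊨f-local (same-play X (suc n)) (imp α' φ) (spec s)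
      where
      spec : Stop X n → suc n , play σ X ⊨f imp α' φ
      spec (inj₁ e)  = inj₂ (wins X n e)
      spec (inj₂ ¬h) = inj₁ ¬h

    realizes : ∀ X → ∃[ n ] (Ends σ' X n × (∀ m → Ends σ' X m → m ≡ n) ×
                             (suc n , play σ' X ⊨f imp α' φ))
    realizes X with minimal-witness lem (Stop X) (proj₂ (eventually-stops X))
    ... | n , first = n , Q⇒ends X n first ,
                      (λ m e → minimal-unique (ends⇒Q X m e) first) , stop⇒spec X n (proj₁ first)

  backward : RealizableF nx ny (imp α' φ) → RealizableC nx ny α φ
  backward (σ' , realizes) = σ , at-most-once , α-strategy , wins
    where
    Stop : (ℕ → Val (Fin nx)) → ℕ → Set
    Stop X n = Ends σ' X n × suc n , play σ' X ⊨f α'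

    stop-agree : PrefixInvariant Stop
    stop-agree ag (e , h) = ends-agree σ' ag ≤-refl e , ⊨f-local (play-agree σ' ag ≤-refl) α' h

    open Reschedule lem σ' Stop stop-agree
    σ = rescheduled

    at-most-once : AtMostOnce σ
    at-most-once X m n em en with realizes X
    ... | _ , _ , unique , _ =
      trans (unique m (proj₁ (ends⇒Q X m em))) (sym (unique n (proj₁ (ends⇒Q X n en))))

    -- if σ does not end, α' failed where σ' ended, so α fails on the play
    α-strategy : IsAlphaStrategy α σ
    α-strategy X with realizes X
    ... | k , ek , _ , _ with lem {suc k , play σ' X ⊨f α'}
    ...   | yes h  = inj₁ (k , Q⇒ends X k (ek , h))
    ...   | no ¬h  = inj₂ (λ hα → ¬h (⊨f-local (sameUpTo-sym (same-play X (suc k))) α'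
                             (SafeFormulas.safe⇒weak-on-prefixes (play σ X) sa (s≤s z≤n) hα)))

    wins : ∀ X n → Ends σ X n → suc n , play σ X ⊨f φ
    wins X n e with ends⇒Q X n e | realizes X
    ... | en , hα' | k , _ , unique , spec with unique n en
    ...   | refl with spec
    ...     | inj₁ ¬hα' = ⊥-elim (¬hα' hα')
    ...     | inj₂ hφ   = ⊨f-local (same-play X (suc n)) φ hφ

theorem4 : ExcludedMiddle 0ℓ →
    ∀ (nx ny : ℕ) (α φ : LTL (Prop nx ny)) → Safe α →
    RealizableC nx ny α φ ⇔ RealizableF nx ny (imp (weaken α) φ)
theorem4 lem nx ny α φ sa = mk⇔ forward backward
  where open Directions lem nx ny α φ sa
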